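{- For every integer $n \geq 3$, $\beta_E(GP(n,1)) = 3$.
   Context: The generalized Petersen graph $GP(n,k)$, for $n\ge 3$ and $1\le k<n/2$, has vertex set $\{u_i, v_i : 0\le i\le n-1\}$ and edge set $\{u_iu_{i+1}, u_iv_i, v_iv_{i+k} : 0\le i\le n-1\}$, indices taken modulo $n$. For vertices $u,v$, $d(u,v)$ is the shortest-path distance; for a vertex $w$ and edge $uv$, $d(w,uv)=\min\{d(w,u),d(w,v)\}$. A vertex $w$ resolves edges $e_1,e_2$ if $d(w,e_1)\ne d(w,e_2)$. A vertex set $S$ is an edge metric generator if every two distinct edges are resolved by some vertex of $S$; the edge metric dimension $\beta_E(G)$ is the minimum cardinality of an edge metric generator of $G$. -}

module Defs where

open import Data.Nat using (ℕ; zero; suc; _+_; _≤_; _<_; _*_; _⊓_)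
open import Data.Fin using (Fin; toℕ)
open import Data.Product using (Σ; ∃; ∃-syntax; _×_; _,_)
open import Data.Sum using (_⊎_)
open import Data.List using (List; length)
open import Data.List.Membership.Propositional using (_∈_)
open import Data.List.Relation.Unary.Unique.Propositional using (Unique)
open import Relation.Binary.PropositionalEquality using (_≡_; _≢_)
open import Relation.Nullary using (¬_)

data Vtx (n : ℕ) : Set where
  u : Fin n → Vtx n
  v : Fin n → Vtx n

-- "j = i + s (mod n)" for i j : Fin n and 0 ≤ s < n, without division.
_≡_+_modn : ∀ {n} → Fin n → Fin n → ℕ → Set
_≡_+_modn {n} j i s = (toℕ i + s ≡ toℕ j) ⊎ (toℕ i + s ≡ toℕ j + n)

data Adj (n k : ℕ) : Vtx n → Vtx n → Set where
  outer→ : ∀ {i j} → j ≡ i + 1 modn → Adj n k (u i) (u j)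
  outer← : ∀ {i j} → i ≡ j + 1 modn → Adj n k (u i) (u j)
  spokeUV : ∀ {i} → Adj n k (u i) (v i)
  spokeVU : ∀ {i} → Adj n k (v i) (u i)
  inner→ : ∀ {i j} → j ≡ i + k modn → Adj n k (v i) (v j)
  inner← : ∀ {i j} → i ≡ j + k modn → Adj n k (v i) (v j)

data Walk (n k : ℕ) : Vtx n → Vtx n → ℕ → Set where
  here : ∀ {a} → Walk n k a a zero
  step : ∀ {a b c m} → Adj n k a b → Walk n k b c m → Walk n k a c (suc m)

Dist : (n k : ℕ) → Vtx n → Vtx n → ℕ → Set
Dist n k a b m = Walk n k a b m × (∀ j → Walk n k a b j → m ≤ j)

-- An edge: an (ordered representative of an) adjacent pair.
Edge : ℕ → ℕ → Set
Edge n k = Σ (Vtx n × Vtx n) λ { (a , b) → Adj n k a b }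

SameEdge : ∀ {n k} → Edge n k → Edge n k → Set
SameEdge ((a , b) , _) ((c , d) , _) = (a ≡ c × b ≡ d) ⊎ (a ≡ d × b ≡ c)

EdgeDist : (n k : ℕ) → Vtx n → Edge n k → ℕ → Set
EdgeDist n k w ((a , b) , _) m =
  ∃[ da ] ∃[ db ] (Dist n k w a da × Dist n k w b db × m ≡ da ⊓ db)

Resolves : (n k : ℕ) → Vtx n → Edge n k → Edge n k → Set
Resolves n k w e₁ e₂ =
  ∃[ m₁ ] ∃[ m₂ ] (EdgeDist n k w e₁ m₁ × EdgeDist n k w e₂ m₂ × m₁ ≢ m₂)

-- S (a list without repetitions, i.e. a finite vertex set) is an edge metric generator.
IsEdgeMetricGenerator : (n k : ℕ) → List (Vtx n) → Set
IsEdgeMetricGenerator n k S =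
  (e₁ e₂ : Edge n k) → ¬ SameEdge e₁ e₂ → ∃[ w ] (w ∈ S × Resolves n k w e₁ e₂)

EdgeMetricDim : (n k : ℕ) → ℕ → Set
EdgeMetricDim n k β =
  (∃[ S ] (Unique S × IsEdgeMetricGenerator n k S × length S ≡ β))
  × (∀ S → Unique S → IsEdgeMetricGenerator n k S → β ≤ length S)

module Submission where

-- Upper bound: seen from u₀, a vertex of either ring at cyclic position x lies at distance c(x)
-- or c(x) + 1, where c is the distance from 0 on the n-cycle; symmetrically from v₀. With a(x)
-- the distance from 0 to the cycle edge {x, x + 1}, an outer edge is seen from (u₀, v₀) at
-- (a, a + 1), a spoke at (c, c) and an inner edge at (a + 1, a), which separates the three
-- kinds; u₁ sees the same picture rotated by one position, and two consecutive rotations of c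
-- (or of a) pin down the position. Lower bound: GP(n,1) is cubic, and a second vertex sees the
-- three edges at a vertex w only at distances d and d − 1, so with at most two vertices two of
-- them stay unresolved.

open import Defs
open import Data.Bool using (Bool; true; false; not)
open import Data.Empty using (⊥-elim)
open import Function using (id)
open import Data.Fin using (Fin; toℕ; fromℕ<) renaming (zero to 0F; suc to sucF)
open import Data.Fin.Properties using (toℕ-fromℕ<; fromℕ<-toℕ; toℕ<n; toℕ-injective)
open import Data.List using (List; []; _∷_; length)
open import Data.List.Relation.Binary.Subset.Propositional using (_⊆_)
open import Data.List.Relation.Unary.Any using (here; there)
open import Data.List.Relation.Unary.AllPairs using ([]; _∷_)
open import Data.List.Relation.Unary.All using ([]; _∷_)
open import Data.List.Relation.Unary.Unique.Propositional using (Unique)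
open import Data.Nat using (ℕ; zero; suc; _+_; _∸_; _≤_; _<_; _⊓_; z≤n; s≤s; s≤s⁻¹; z<s)
open import Data.Nat.Properties
open import Data.Product using (∃-syntax; _×_; _,_; proj₁; proj₂)
open import Data.Sum using (_⊎_; inj₁; inj₂; [_,_])
open import Relation.Binary.PropositionalEquality
  using (_≡_; _≢_; refl; sym; trans; cong; cong₂; subst; subst₂)
open import Relation.Nullary using (¬_; yes; no)

module _ {n k : ℕ} where

  edge : ∀ {a b} → Adj n k a b → Edge n k
  edge {a} {b} adj = (a , b) , adj

  Adj-sym : ∀ {a b} → Adj n k a b → Adj n k b a
  Adj-sym (outer→ r) = outer← r
  Adj-sym (outer← r) = outer→ r
  Adj-sym spokeUV = spokeVU
  Adj-sym spokeVU = spokeUV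
  Adj-sym (inner→ r) = inner← r
  Adj-sym (inner← r) = inner→ r

  _++ʷ_ : ∀ {a b c i j} → Walk n k a b i → Walk n k b c j → Walk n k a c (i + j)
  here ++ʷ q = q
  step adj p ++ʷ q = step adj (p ++ʷ q)

  Dist-unique : ∀ {w x d d′} → Dist n k w x d → Dist n k w x d′ → d ≡ d′
  Dist-unique (p , p-min) (q , q-min) = ≤-antisym (p-min _ q) (q-min _ p)

  EdgeDist-unique : ∀ {w} e {m m′} → EdgeDist n k w e m → EdgeDist n k w e m′ → m ≡ m′
  EdgeDist-unique _ (_ , _ , da , db , m≡) (_ , _ , da′ , db′ , m′≡) =
    trans m≡ (trans (cong₂ _⊓_ (Dist-unique da da′) (Dist-unique db db′)) (sym m′≡))

  Resolves-≢ : ∀ {w} e₁ e₂ {m₁ m₂} → Resolves n k w e₁ e₂ →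
               EdgeDist n k w e₁ m₁ → EdgeDist n k w e₂ m₂ → m₁ ≢ m₂
  Resolves-≢ e₁ e₂ (_ , _ , ed₁ , ed₂ , ≢) ed₁′ ed₂′ m₁≡m₂ =
    ≢ (trans (EdgeDist-unique e₁ ed₁ ed₁′) (trans m₁≡m₂ (EdgeDist-unique e₂ ed₂′ ed₂)))

  EdgeDist-self : ∀ {w y m} (adj : Adj n k w y) → EdgeDist n k w (edge adj) m → m ≡ 0
  EdgeDist-self _ (_ , db , dw , _ , m≡) = trans m≡ (cong (_⊓ db) (n≤0⇒n≡0 (proj₂ dw 0 here)))

  Near : ℕ → ℕ → Set
  Near d m = m ≡ d ⊎ suc m ≡ d

  -- The far endpoint b is at distance at least d(w,a) − 1, via the edge back to a.
  EdgeDist-incident : ∀ {w a b d m} (adj : Adj n k a b) → Dist n k w a d →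
                      EdgeDist n k w (edge adj) m → Near d m
  EdgeDist-incident adj wa (da , db , wa′ , wb , m≡) with Dist-unique wa′ wa
  ... | refl with da ≤? db
  ...   | yes da≤db = inj₁ (trans m≡ (m≤n⇒m⊓n≡m da≤db))
  ...   | no da≰db = inj₂ (trans (cong suc (trans m≡ (m≥n⇒m⊓n≡n (<⇒≤ db<da))))
                       (≤-antisym db<da da≤1+db))
    where
    db<da = ≰⇒> da≰db
    da≤1+db = subst (da ≤_) (+-comm db 1) (proj₂ wa _ (proj₁ wb ++ʷ step (Adj-sym adj) here))

  Near-pigeonhole : ∀ {d x y z} → Near d x → Near d y → Near d z → x ≡ y ⊎ x ≡ z ⊎ y ≡ z
  Near-pigeonhole (inj₁ x≡) (inj₁ y≡) _ = inj₁ (trans x≡ (sym y≡))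
  Near-pigeonhole (inj₂ x≡) (inj₂ y≡) _ = inj₁ (suc-injective (trans x≡ (sym y≡)))
  Near-pigeonhole (inj₁ x≡) (inj₂ _) (inj₁ z≡) = inj₂ (inj₁ (trans x≡ (sym z≡)))
  Near-pigeonhole (inj₁ _) (inj₂ y≡) (inj₂ z≡) = inj₂ (inj₂ (suc-injective (trans y≡ (sym z≡))))
  Near-pigeonhole (inj₂ _) (inj₁ y≡) (inj₁ z≡) = inj₂ (inj₂ (trans y≡ (sym z≡)))
  Near-pigeonhole (inj₂ x≡) (inj₁ _) (inj₂ z≡) = inj₂ (inj₁ (suc-injective (trans x≡ (sym z≡))))

  record Claw (w : Vtx n) : Set where
    constructor mkClaw
    field
      {y₁ y₂ y₃} : Vtx n
      adj₁ : Adj n k w y₁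
      adj₂ : Adj n k w y₂
      adj₃ : Adj n k w y₃
      y₁≢y₂ : y₁ ≢ y₂
      y₁≢y₃ : y₁ ≢ y₃
      y₂≢y₃ : y₂ ≢ y₃

  incident-distinct : ∀ {w y y′} (adj : Adj n k w y) (adj′ : Adj n k w y′) →
                      y ≢ y′ → ¬ SameEdge (edge adj) (edge adj′)
  incident-distinct _ _ y≢y′ (inj₁ (_ , y≡y′)) = y≢y′ y≡y′
  incident-distinct _ _ y≢y′ (inj₂ (w≡y′ , y≡w)) = y≢y′ (trans y≡w w≡y′)

  generator-⊆ : ∀ {S T} → S ⊆ T → IsEdgeMetricGenerator n k S → IsEdgeMetricGenerator n k T
  generator-⊆ S⊆T gen e₁ e₂ e₁≉e₂ with gen e₁ e₂ e₁≉e₂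
  ... | w , w∈S , res = w , S⊆T w∈S , res

  resolved-by-second : ∀ {w w′ y y′} (adj : Adj n k w y) (adj′ : Adj n k w y′) → y ≢ y′ →
                       IsEdgeMetricGenerator n k (w ∷ w′ ∷ []) →
                       Resolves n k w′ (edge adj) (edge adj′)
  resolved-by-second adj adj′ y≢y′ gen
    with gen (edge adj) (edge adj′) (incident-distinct adj adj′ y≢y′)
  ... | _ , here refl , _ , _ , ed , ed′ , ≢ =
    ⊥-elim (≢ (trans (EdgeDist-self adj ed) (sym (EdgeDist-self adj′ ed′))))
  ... | _ , there (here refl) , res = res

  -- A second vertex sees the three edges of a claw at only two distances d(w′,w) and d(w′,w) − 1.
  claw-needs-three : ∀ {w w′} → Claw w → ¬ IsEdgeMetricGenerator n k (w ∷ w′ ∷ [])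
  claw-needs-three (mkClaw adj₁ adj₂ adj₃ y₁≢y₂ y₁≢y₃ y₂≢y₃) gen
    with r₁₂ ← resolved-by-second adj₁ adj₂ y₁≢y₂ gen
       | r₁₃ ← resolved-by-second adj₁ adj₃ y₁≢y₃ gen
       | r₂₃ ← resolved-by-second adj₂ adj₃ y₂≢y₃ gen
    with r₁₂ | r₁₃
  ... | _ , _ , ed₁@(_ , _ , w′w , _) , ed₂ , _ | _ , _ , _ , ed₃ , _ =
    [ Resolves-≢ (edge adj₁) (edge adj₂) r₁₂ ed₁ ed₂
    , [ Resolves-≢ (edge adj₁) (edge adj₃) r₁₃ ed₁ ed₃
      , Resolves-≢ (edge adj₂) (edge adj₃) r₂₃ ed₂ ed₃ ] ]
    (Near-pigeonhole (EdgeDist-incident adj₁ w′w ed₁) (EdgeDist-incident adj₂ w′w ed₂)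
                     (EdgeDist-incident adj₃ w′w ed₃))

  three-≤-generator : (∀ w → Claw w) → Vtx n →
                      ∀ S → IsEdgeMetricGenerator n k S → 3 ≤ length S
  three-≤-generator claws w [] gen =
    ⊥-elim (claw-needs-three {w′ = w} (claws w) (generator-⊆ (λ ()) gen))
  three-≤-generator claws _ (w ∷ []) gen =
    ⊥-elim (claw-needs-three {w′ = w} (claws w) (generator-⊆ (λ { (here refl) → here refl }) gen))
  three-≤-generator claws _ (w ∷ _ ∷ []) gen = ⊥-elim (claw-needs-three (claws w) gen)
  three-≤-generator claws _ (_ ∷ _ ∷ _ ∷ _) gen = s≤s (s≤s (s≤s z≤n))

  Walk-⊓ : ∀ {a b p q} → Walk n k a b p → Walk n k a b q → Walk n k a b (p ⊓ q)
  Walk-⊓ {p = p} {q} wp wq with ⊓-sel p q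
  ... | inj₁ p⊓q≡p = subst (Walk n k _ _) (sym p⊓q≡p) wp
  ... | inj₂ p⊓q≡q = subst (Walk n k _ _) (sym p⊓q≡q) wq

  Lipschitz : (Vtx n → ℕ) → Set
  Lipschitz f = ∀ {a b} → Adj n k a b → f b ≤ suc (f a)

  Lipschitz-walk : ∀ {f} → Lipschitz f → ∀ {a b l} → Walk n k a b l → f b ≤ f a + l
  Lipschitz-walk lip here = m≤m+n _ 0
  Lipschitz-walk {f} lip (step {a} {m = l} adj p) =
    ≤-trans (Lipschitz-walk lip p)
            (≤-trans (+-monoˡ-≤ l (lip adj)) (≤-reflexive (sym (+-suc (f a) l))))

  Dist-of-potential : ∀ {f w} → Lipschitz f → f w ≡ 0 → (∀ x → Walk n k w x (f x)) →
                      ∀ x → Dist n k w x (f x)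
  Dist-of-potential {f} lip fw≡0 walk x =
    walk x , λ l p → subst (λ z → f x ≤ z + l) fw≡0 (Lipschitz-walk lip p)

  edgeValue : (Vtx n → ℕ) → Edge n k → ℕ
  edgeValue f ((a , b) , _) = f a ⊓ f b

  Resolves-of-potential : ∀ {f w} → (∀ x → Dist n k w x (f x)) →
                          ∀ e₁ e₂ → edgeValue f e₁ ≢ edgeValue f e₂ → Resolves n k w e₁ e₂
  Resolves-of-potential dist _ _ ≢ =
    _ , _ , (_ , _ , dist _ , dist _ , refl) , (_ , _ , dist _ , dist _ , refl) , ≢

ring : ∀ {n} → Bool → Fin n → Vtx n
ring true = u
ring false = v

ring-injective : ∀ {n b} {i j : Fin n} → ring b i ≡ ring b j → i ≡ j
ring-injective {b = true} refl = refl
ring-injective {b = false} refl = refl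

ring≢ring-not : ∀ {n b} {i j : Fin n} → ring b i ≢ ring (not b) j
ring≢ring-not {b = true} ()
ring≢ring-not {b = false} ()

ring-adj : ∀ {n} b {i j : Fin n} → j ≡ i + 1 modn → Adj n 1 (ring b i) (ring b j)
ring-adj true r = outer→ r
ring-adj false r = inner→ r

ring-adj⁻ : ∀ {n} b {i j : Fin n} → i ≡ j + 1 modn → Adj n 1 (ring b i) (ring b j)
ring-adj⁻ true r = outer← r
ring-adj⁻ false r = inner← r

spoke-adj : ∀ {n k} b {i : Fin n} → Adj n k (ring b i) (ring (not b) i)
spoke-adj true = spokeUV
spoke-adj false = spokeVU

-- fold N x is the distance from 0 to x on an N-cycle, and fold (N − 1) x the distance from 0 to
-- the edge {x, x + 1}.
fold : ℕ → ℕ → ℕ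
fold L x = x ⊓ (L ∸ x)

fold-injective : ∀ L {x y} → x ≤ L → y ≤ L → fold L x ≡ fold L y → x ≡ y ⊎ x + y ≡ L
fold-injective L {x} {y} x≤L y≤L eq with ⊓-sel x (L ∸ x) | ⊓-sel y (L ∸ y)
... | inj₁ fx | inj₁ fy = inj₁ (trans (sym fx) (trans eq fy))
... | inj₁ fx | inj₂ fy = inj₂ (trans (cong (_+ y) (trans (sym fx) (trans eq fy))) (m∸n+n≡m y≤L))
... | inj₂ fx | inj₁ fy =
  inj₂ (trans (cong (x +_) (sym (trans (sym fx) (trans eq fy)))) (m+[n∸m]≡n x≤L))
... | inj₂ fx | inj₂ fy = inj₁ (+-cancelʳ-≡ (L ∸ x) x y
        (trans (+-comm x (L ∸ x)) (trans (m∸n+n≡m x≤L)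
          (sym (trans (cong (y +_) (trans (sym fx) (trans eq fy))) (m+[n∸m]≡n y≤L))))))

[1+x]⊓t≤1+[x⊓[1+t]] : ∀ x t → suc x ⊓ t ≤ suc (x ⊓ suc t)
[1+x]⊓t≤1+[x⊓[1+t]] x t = ⊓-monoʳ-≤ (suc x) (≤-trans (n≤1+n t) (n≤1+n (suc t)))

x⊓[1+t]≤1+[[1+x]⊓t] : ∀ x t → x ⊓ suc t ≤ suc (suc x ⊓ t)
x⊓[1+t]≤1+[[1+x]⊓t] x t = ⊓-monoˡ-≤ (suc t) (≤-trans (n≤1+n x) (n≤1+n (suc x)))

[x⊓[1+t]]⊓[[1+x]⊓t]≡x⊓t : ∀ x t → (x ⊓ suc t) ⊓ (suc x ⊓ t) ≡ x ⊓ t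
[x⊓[1+t]]⊓[[1+x]⊓t]≡x⊓t zero t = refl
[x⊓[1+t]]⊓[[1+x]⊓t]≡x⊓t (suc x) zero = ⊓-zeroʳ (suc x ⊓ 1)
[x⊓[1+t]]⊓[[1+x]⊓t]≡x⊓t (suc x) (suc t) = cong suc ([x⊓[1+t]]⊓[[1+x]⊓t]≡x⊓t x t)

module Prism (m : ℕ) where

  N K : ℕ
  N = 3 + m
  K = 2 + m

  Succ : ℕ → ℕ → Set
  Succ x y = (x + 1 ≡ y) ⊎ (x + 1 ≡ y + N)

  Succ-view : ∀ {x y} → x < N → Succ x y → y ≡ suc x ⊎ (y ≡ 0 × x ≡ K)
  Succ-view {x} _ (inj₁ x+1≡y) = inj₁ (trans (sym x+1≡y) (+-comm x 1))
  Succ-view {x} {zero} _ (inj₂ x+1≡N) = inj₂ (refl , suc-injective (trans (+-comm 1 x) x+1≡N))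
  Succ-view {x} {suc y} x<N (inj₂ x+1≡y+N) =
    ⊥-elim (<-irrefl (trans (+-comm 1 x) x+1≡y+N) (≤-trans (s≤s x<N) (s≤s (m≤n+m N y))))

  Succ-functional : ∀ {x y y′} → x < N → y < N → y′ < N → Succ x y → Succ x y′ → y ≡ y′
  Succ-functional x<N y<N y′<N r r′ with Succ-view x<N r | Succ-view x<N r′
  ... | inj₁ y≡ | inj₁ y′≡ = trans y≡ (sym y′≡)
  ... | inj₁ refl | inj₂ (_ , refl) = ⊥-elim (<-irrefl refl y<N)
  ... | inj₂ (_ , refl) | inj₁ refl = ⊥-elim (<-irrefl refl y′<N)
  ... | inj₂ (y≡0 , _) | inj₂ (y′≡0 , _) = trans y≡0 (sym y′≡0)

  -- This is where n ≥ 3 enters: for n = 2, both 0 → 1 and 1 → 0 are successor steps.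
  Succ-asym : ∀ {x y} → x < N → y < N → Succ x y → ¬ Succ y x
  Succ-asym x<N y<N r r′ with Succ-view x<N r | Succ-view y<N r′
  ... | inj₁ refl | inj₁ x≡ = m≢1+n+m _ {1} x≡
  ... | inj₁ refl | inj₂ (refl , ())
  ... | inj₂ (refl , refl) | inj₁ ()
  ... | inj₂ (refl , refl) | inj₂ (() , _)

  Succ-total : ∀ {x} → x < N → ∃[ y ] (y < N × Succ x y)
  Succ-total {x} x<N with x ≟ K
  ... | yes refl = 0 , z<s , inj₂ (+-comm K 1)
  ... | no x≢K = suc x , s≤s (≤∧≢⇒< (s≤s⁻¹ x<N) x≢K) , inj₁ (+-comm x 1)

  prev : ℕ → ℕ
  prev zero = K
  prev (suc x) = x

  prev<N : ∀ {x} → x < N → prev x < N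
  prev<N {zero} _ = ≤-refl
  prev<N {suc x} x<N = ≤-trans (n≤1+n _) x<N

  prev-injective : ∀ {x y} → x < N → y < N → prev x ≡ prev y → x ≡ y
  prev-injective {zero} {zero} _ _ _ = refl
  prev-injective {zero} {suc y} _ y<N K≡y = ⊥-elim (<-irrefl (cong suc (sym K≡y)) y<N)
  prev-injective {suc x} {zero} x<N _ x≡K = ⊥-elim (<-irrefl (cong suc x≡K) x<N)
  prev-injective {suc x} {suc y} _ _ x≡y = cong suc x≡y

  Succ-prev : ∀ x → Succ (prev x) x
  Succ-prev zero = inj₂ (+-comm K 1)
  Succ-prev (suc x) = inj₁ (+-comm x 1)

  prev-Succ : ∀ {x y} → x < N → Succ x y → Succ (prev x) (prev y)
  prev-Succ {x} x<N r with Succ-view x<N r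
  prev-Succ {zero} _ _ | inj₁ refl = inj₂ (+-comm K 1)
  prev-Succ {suc x} _ _ | inj₁ refl = inj₁ (+-comm x 1)
  ... | inj₂ (refl , refl) = inj₁ (+-comm (suc m) 1)

  cyc cycEdge : ℕ → ℕ
  cyc = fold N
  cycEdge = fold K

  cyc-unfold : ∀ {x} → x < N → cyc x ≡ x ⊓ suc (K ∸ x)
  cyc-unfold {x} x<N = cong (x ⊓_) (+-∸-assoc 1 (s≤s⁻¹ x<N))

  cyc-K : cyc K ≡ 1
  cyc-K = cong (K ⊓_) (m+n∸n≡m 1 K)

  cyc-Succ : ∀ {x y} → x < N → Succ x y → cyc y ≤ suc (cyc x) × cyc x ≤ suc (cyc y)
  cyc-Succ {x} x<N r with Succ-view x<N r
  ... | inj₁ refl rewrite cyc-unfold x<N =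
    [1+x]⊓t≤1+[x⊓[1+t]] x (K ∸ x) , x⊓[1+t]≤1+[[1+x]⊓t] x (K ∸ x)
  ... | inj₂ (refl , refl) = z≤n , ≤-reflexive cyc-K

  cyc-⊓-Succ : ∀ {x y} → x < N → Succ x y → cyc x ⊓ cyc y ≡ cycEdge x
  cyc-⊓-Succ {x} x<N r with Succ-view x<N r
  ... | inj₁ refl =
    trans (cong (_⊓ cyc (suc x)) (cyc-unfold x<N)) ([x⊓[1+t]]⊓[[1+x]⊓t]≡x⊓t x (K ∸ x))
  ... | inj₂ (refl , refl) =
    trans (⊓-zeroʳ (cyc K)) (sym (trans (cong (K ⊓_) (n∸n≡0 K)) (⊓-zeroʳ K)))

  +≡N⇒prev+prev≢N : ∀ {x y} → x < N → y < N → x + y ≡ N → prev x + prev y ≢ N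
  +≡N⇒prev+prev≢N {zero} _ y<N y≡N _ = <-irrefl y≡N y<N
  +≡N⇒prev+prev≢N {suc x} {zero} x<N _ x+0≡N _ = <-irrefl (trans (sym (+-identityʳ _)) x+0≡N) x<N
  +≡N⇒prev+prev≢N {suc x} {suc y} _ _ s₁ s₂ =
    m≢1+n+m N {1} (sym (trans (sym (cong suc (trans (+-suc x y) (cong suc s₂)))) s₁))

  +≡K⇒prev+prev≢K : ∀ x y → x + y ≡ K → prev x + prev y ≢ K
  +≡K⇒prev+prev≢K zero _ refl s₂ = m+1+n≢m K s₂
  +≡K⇒prev+prev≢K (suc x) zero s₁ s₂ with suc-injective (trans (sym (+-identityʳ _)) s₁)
  ... | refl = m+1+n≢m K (trans (+-comm K (suc m)) s₂)
  +≡K⇒prev+prev≢K (suc x) (suc y) s₁ s₂ =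
    m≢1+n+m K {1} (sym (trans (sym (cong suc (trans (+-suc x y) (cong suc s₂)))) s₁))

  cyc-prev-injective : ∀ {x y} → x < N → y < N →
                       cyc x ≡ cyc y → cyc (prev x) ≡ cyc (prev y) → x ≡ y
  cyc-prev-injective x<N y<N eq eq′ with fold-injective N (<⇒≤ x<N) (<⇒≤ y<N) eq
  ... | inj₁ x≡y = x≡y
  ... | inj₂ s with fold-injective N (<⇒≤ (prev<N x<N)) (<⇒≤ (prev<N y<N)) eq′
  ...   | inj₁ px≡py = prev-injective x<N y<N px≡py
  ...   | inj₂ s′ = ⊥-elim (+≡N⇒prev+prev≢N x<N y<N s s′)

  cycEdge-prev-injective : ∀ {x y} → x < N → y < N →
                           cycEdge x ≡ cycEdge y → cycEdge (prev x) ≡ cycEdge (prev y) → x ≡ y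
  cycEdge-prev-injective {x} {y} x<N y<N eq eq′
    with fold-injective K (s≤s⁻¹ x<N) (s≤s⁻¹ y<N) eq
  ... | inj₁ x≡y = x≡y
  ... | inj₂ s with fold-injective K (s≤s⁻¹ (prev<N x<N)) (s≤s⁻¹ (prev<N y<N)) eq′
  ...   | inj₁ px≡py = prev-injective x<N y<N px≡py
  ...   | inj₂ s′ = ⊥-elim (+≡K⇒prev+prev≢K x y s s′)

  ringAt : Bool → (x : ℕ) → .(x < N) → Vtx N
  ringAt b x x<N = ring b (fromℕ< x<N)

  ringAt-toℕ : ∀ b (i : Fin N) → ringAt b (toℕ i) (toℕ<n i) ≡ ring b i
  ringAt-toℕ b i = cong (ring b) (fromℕ<-toℕ i (toℕ<n i))

  ringAt-adj : ∀ b {x y} (x<N : x < N) (y<N : y < N) → Succ x y →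
               Adj N 1 (ringAt b x x<N) (ringAt b y y<N)
  ringAt-adj b x<N y<N r = ring-adj b (subst₂ Succ (sym (toℕ-fromℕ< x<N)) (sym (toℕ-fromℕ< y<N)) r)

  ringAt-adj⁻ : ∀ b {x y} (x<N : x < N) (y<N : y < N) → Succ y x →
                Adj N 1 (ringAt b x x<N) (ringAt b y y<N)
  ringAt-adj⁻ b x<N y<N r = ring-adj⁻ b (subst₂ Succ (sym (toℕ-fromℕ< y<N)) (sym (toℕ-fromℕ< x<N)) r)

  ring-walk-up : ∀ b l x y → l + x ≡ y → (x<N : x < N) (y<N : y < N) →
                 Walk N 1 (ringAt b x x<N) (ringAt b y y<N) l
  ring-walk-up b zero x .x refl x<N y<N = here
  ring-walk-up b (suc l) x y l+1+x≡y x<N y<N =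
    step (ringAt-adj b x<N 1+x<N (inj₁ (+-comm x 1)))
         (ring-walk-up b l (suc x) y (trans (+-suc l x) l+1+x≡y) 1+x<N y<N)
    where
    1+x<N : suc x < N
    1+x<N = ≤-<-trans (subst (suc x ≤_) l+1+x≡y (s≤s (m≤n+m x l))) y<N

  ring-walk-down : ∀ b l x y → l + y ≡ x → (x<N : x < N) (y<N : y < N) →
                   Walk N 1 (ringAt b x x<N) (ringAt b y y<N) l
  ring-walk-down b zero x .x refl x<N y<N = here
  ring-walk-down b (suc l) .(suc (l + y)) y refl x<N y<N =
    step (ringAt-adj⁻ b x<N l+y<N (inj₁ (+-comm (l + y) 1)))
         (ring-walk-down b l (l + y) y refl l+y<N y<N)
    where
    l+y<N : l + y < N
    l+y<N = ≤-trans (n≤1+n _) x<N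

  1<N : 1 < N
  1<N = s≤s (s≤s z≤n)

  ring-wrap : ∀ b → Adj N 1 (ring b 0F) (ringAt b K ≤-refl)
  ring-wrap b = ringAt-adj⁻ b z<s ≤-refl (inj₂ (+-comm K 1))

  ring-walk-from-0 : ∀ b x (x<N : x < N) → Walk N 1 (ring b 0F) (ringAt b x x<N) (cyc x)
  ring-walk-from-0 b x x<N =
    subst (Walk N 1 _ _) (sym (cyc-unfold x<N))
      (Walk-⊓ (ring-walk-up b x 0 x (+-identityʳ x) z<s x<N)
              (step (ring-wrap b) (ring-walk-down b (K ∸ x) K x (m∸n+n≡m (s≤s⁻¹ x<N)) ≤-refl x<N)))

  ring-walk-from-1 : ∀ b x (x<N : x < N) →
                     Walk N 1 (ring b (sucF 0F)) (ringAt b x x<N) (cyc (prev x))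
  ring-walk-from-1 b zero _ =
    subst (Walk N 1 _ _) (sym cyc-K) (step (ringAt-adj⁻ b 1<N z<s (inj₁ refl)) here)
  ring-walk-from-1 b (suc x) 1+x<N =
    subst (Walk N 1 _ _) (cong (x ⊓_) (sym (+-∸-assoc 2 (s≤s⁻¹ (s≤s⁻¹ 1+x<N)))))
      (Walk-⊓ (ring-walk-up b x 1 (suc x) (+-comm x 1) 1<N 1+x<N)
              (step (ringAt-adj⁻ b 1<N z<s (inj₁ refl))
                (step (ring-wrap b)
                  (ring-walk-down b (K ∸ suc x) K (suc x) (m∸n+n≡m (s≤s⁻¹ 1+x<N)) ≤-refl 1+x<N))))

  record Rotation (g : ℕ → ℕ) : Set where
    field
      bounded : ∀ {x} → x < N → g x < N
      preserves-Succ : ∀ {x y} → x < N → y < N → Succ x y → Succ (g x) (g y)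

  id-rotation : Rotation id
  id-rotation = record { bounded = id ; preserves-Succ = λ _ _ r → r }

  prev-rotation : Rotation prev
  prev-rotation = record { bounded = prev<N ; preserves-Succ = λ x<N _ → prev-Succ x<N }

  -- prismDist b g x is the distance to x from the vertex of ring b whose index g sends to 0.
  prismDist : Bool → (ℕ → ℕ) → Vtx N → ℕ
  prismDist true g (u i) = cyc (g (toℕ i))
  prismDist true g (v i) = suc (cyc (g (toℕ i)))
  prismDist false g (u i) = suc (cyc (g (toℕ i)))
  prismDist false g (v i) = cyc (g (toℕ i))

  module _ {g} (rot : Rotation g) where
    open Rotation rot

    cyc-Succ-rotated : ∀ {i j : Fin N} → Succ (toℕ i) (toℕ j) →
                       cyc (g (toℕ j)) ≤ suc (cyc (g (toℕ i))) ×
                       cyc (g (toℕ i)) ≤ suc (cyc (g (toℕ j)))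
    cyc-Succ-rotated {i} {j} r =
      cyc-Succ (bounded (toℕ<n i)) (preserves-Succ (toℕ<n i) (toℕ<n j) r)

    cyc-⊓-Succ-rotated : ∀ {i j : Fin N} → Succ (toℕ i) (toℕ j) →
                         cyc (g (toℕ i)) ⊓ cyc (g (toℕ j)) ≡ cycEdge (g (toℕ i))
    cyc-⊓-Succ-rotated {i} {j} r =
      cyc-⊓-Succ (bounded (toℕ<n i)) (preserves-Succ (toℕ<n i) (toℕ<n j) r)

    prismDist-Lipschitz : ∀ b → Lipschitz {k = 1} (prismDist b g)
    prismDist-Lipschitz true (outer→ r) = proj₁ (cyc-Succ-rotated r)
    prismDist-Lipschitz false (outer→ r) = s≤s (proj₁ (cyc-Succ-rotated r))
    prismDist-Lipschitz true (outer← r) = proj₂ (cyc-Succ-rotated r)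
    prismDist-Lipschitz false (outer← r) = s≤s (proj₂ (cyc-Succ-rotated r))
    prismDist-Lipschitz true spokeUV = ≤-refl
    prismDist-Lipschitz false spokeUV = ≤-trans (n≤1+n _) (n≤1+n _)
    prismDist-Lipschitz true spokeVU = ≤-trans (n≤1+n _) (n≤1+n _)
    prismDist-Lipschitz false spokeVU = ≤-refl
    prismDist-Lipschitz true (inner→ r) = s≤s (proj₁ (cyc-Succ-rotated r))
    prismDist-Lipschitz false (inner→ r) = proj₁ (cyc-Succ-rotated r)
    prismDist-Lipschitz true (inner← r) = s≤s (proj₂ (cyc-Succ-rotated r))
    prismDist-Lipschitz false (inner← r) = proj₂ (cyc-Succ-rotated r)

    prismDist-Dist : ∀ o → g (toℕ o) ≡ 0 →
                     (∀ b x (x<N : x < N) → Walk N 1 (ring b o) (ringAt b x x<N) (cyc (g x))) →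
                     ∀ b x → Dist N 1 (ring b o) x (prismDist b g x)
    prismDist-Dist o go≡0 ring-walk b = Dist-of-potential (prismDist-Lipschitz b) (origin b) (walk b)
      where
      origin : ∀ b → prismDist b g (ring b o) ≡ 0
      origin true = cong cyc go≡0
      origin false = cong cyc go≡0

      along : ∀ b {a l} i → Walk N 1 a (ringAt b (toℕ i) (toℕ<n i)) l → Walk N 1 a (ring b i) l
      along b i = subst (λ z → Walk N 1 _ z _) (ringAt-toℕ b i)

      walk : ∀ b x → Walk N 1 (ring b o) x (prismDist b g x)
      walk true (u i) = along true i (ring-walk true (toℕ i) (toℕ<n i))
      walk true (v i) = step spokeUV (along false i (ring-walk false (toℕ i) (toℕ<n i)))
      walk false (u i) = step spokeVU (along true i (ring-walk true (toℕ i) (toℕ<n i)))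
      walk false (v i) = along false i (ring-walk false (toℕ i) (toℕ<n i))

  data EdgeKind : Set where
    outer spoke inner : EdgeKind

  kind : Edge N 1 → EdgeKind
  kind (_ , outer→ _) = outer
  kind (_ , outer← _) = outer
  kind (_ , spokeUV) = spoke
  kind (_ , spokeVU) = spoke
  kind (_ , inner→ _) = inner
  kind (_ , inner← _) = inner

  -- The index from which an outer or inner edge steps forward.
  base : Edge N 1 → Fin N
  base (_ , outer→ {i} _) = i
  base (_ , outer← {j = j} _) = j
  base (_ , spokeUV {i}) = i
  base (_ , spokeVU {i}) = i
  base (_ , inner→ {i} _) = i
  base (_ , inner← {j = j} _) = j

  Linked : EdgeKind → Fin N → Fin N → Set
  Linked outer i j = Succ (toℕ i) (toℕ j)
  Linked spoke i j = i ≡ j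
  Linked inner i j = Succ (toℕ i) (toℕ j)

  Linked-functional : ∀ κ {i j j′} → Linked κ i j → Linked κ i j′ → j ≡ j′
  Linked-functional outer {i} {j} {j′} r r′ =
    toℕ-injective (Succ-functional (toℕ<n i) (toℕ<n j) (toℕ<n j′) r r′)
  Linked-functional spoke refl refl = refl
  Linked-functional inner {i} {j} {j′} r r′ =
    toℕ-injective (Succ-functional (toℕ<n i) (toℕ<n j) (toℕ<n j′) r r′)

  endpoints : EdgeKind → Fin N → Fin N → Vtx N × Vtx N
  endpoints outer i j = u i , u j
  endpoints spoke i j = u i , v j
  endpoints inner i j = v i , v j

  Oriented : Vtx N × Vtx N → Vtx N × Vtx N → Set
  Oriented (a , b) q = (a , b) ≡ q ⊎ (b , a) ≡ q

  normalForm : (e : Edge N 1) →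
               ∃[ j ] (Linked (kind e) (base e) j × Oriented (proj₁ e) (endpoints (kind e) (base e) j))
  normalForm (_ , outer→ {j = j} r) = j , r , inj₁ refl
  normalForm (_ , outer← {i} r) = i , r , inj₂ refl
  normalForm (_ , spokeUV {i}) = i , refl , inj₁ refl
  normalForm (_ , spokeVU {i}) = i , refl , inj₂ refl
  normalForm (_ , inner→ {j = j} r) = j , r , inj₁ refl
  normalForm (_ , inner← {i} r) = i , r , inj₂ refl

  SameEdge-of-Oriented : ∀ {a b c d q} → Oriented (a , b) q → Oriented (c , d) q →
                         (a ≡ c × b ≡ d) ⊎ (a ≡ d × b ≡ c)
  SameEdge-of-Oriented (inj₁ refl) (inj₁ refl) = inj₁ (refl , refl)
  SameEdge-of-Oriented (inj₁ refl) (inj₂ refl) = inj₂ (refl , refl)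
  SameEdge-of-Oriented (inj₂ refl) (inj₁ refl) = inj₂ (refl , refl)
  SameEdge-of-Oriented (inj₂ refl) (inj₂ refl) = inj₁ (refl , refl)

  SameEdge-of-kind-base : (e₁ e₂ : Edge N 1) →
                          kind e₁ ≡ kind e₂ → base e₁ ≡ base e₂ → SameEdge e₁ e₂
  SameEdge-of-kind-base e₁ e₂ κ≡ i≡ with normalForm e₁ | normalForm e₂
  ... | _ , l₁ , o₁ | _ , l₂ , o₂ =
    SameEdge-of-Oriented o₁ (subst (Oriented (proj₁ e₂)) (sym (endpoints-unique κ≡ i≡ l₁ l₂)) o₂)
    where
    endpoints-unique : ∀ {κ κ′ i i′ j j′} → κ ≡ κ′ → i ≡ i′ → Linked κ i j → Linked κ′ i′ j′ →
                       endpoints κ i j ≡ endpoints κ′ i′ j′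
    endpoints-unique {κ} {i = i} refl refl l l′ = cong (endpoints κ i) (Linked-functional κ l l′)

  edgeFormula : Bool → (ℕ → ℕ) → EdgeKind → ℕ → ℕ
  edgeFormula true g outer x = cycEdge (g x)
  edgeFormula true g spoke x = cyc (g x)
  edgeFormula true g inner x = suc (cycEdge (g x))
  edgeFormula false g outer x = suc (cycEdge (g x))
  edgeFormula false g spoke x = cyc (g x)
  edgeFormula false g inner x = cycEdge (g x)

  prismDist-edgeValue : ∀ {g} → Rotation g → ∀ b (e : Edge N 1) →
                        edgeValue (prismDist b g) e ≡ edgeFormula b g (kind e) (toℕ (base e))
  prismDist-edgeValue rot true (_ , outer→ r) = cyc-⊓-Succ-rotated rot r
  prismDist-edgeValue rot false (_ , outer→ r) = cong suc (cyc-⊓-Succ-rotated rot r)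
  prismDist-edgeValue rot true (_ , outer← r) = trans (⊓-comm _ _) (cyc-⊓-Succ-rotated rot r)
  prismDist-edgeValue rot false (_ , outer← r) = cong suc (trans (⊓-comm _ _) (cyc-⊓-Succ-rotated rot r))
  prismDist-edgeValue rot true (_ , spokeUV) = m≤n⇒m⊓n≡m (n≤1+n _)
  prismDist-edgeValue rot false (_ , spokeUV) = m≥n⇒m⊓n≡n (n≤1+n _)
  prismDist-edgeValue rot true (_ , spokeVU) = m≥n⇒m⊓n≡n (n≤1+n _)
  prismDist-edgeValue rot false (_ , spokeVU) = m≤n⇒m⊓n≡m (n≤1+n _)
  prismDist-edgeValue rot true (_ , inner→ r) = cong suc (cyc-⊓-Succ-rotated rot r)
  prismDist-edgeValue rot false (_ , inner→ r) = cyc-⊓-Succ-rotated rot r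
  prismDist-edgeValue rot true (_ , inner← r) = cong suc (trans (⊓-comm _ _) (cyc-⊓-Succ-rotated rot r))
  prismDist-edgeValue rot false (_ , inner← r) = trans (⊓-comm _ _) (cyc-⊓-Succ-rotated rot r)

  edgeFormula-≡ : ∀ {g} → Rotation g → ∀ b (e₁ e₂ : Edge N 1) →
                  edgeValue (prismDist b g) e₁ ≡ edgeValue (prismDist b g) e₂ →
                  edgeFormula b g (kind e₁) (toℕ (base e₁)) ≡ edgeFormula b g (kind e₂) (toℕ (base e₂))
  edgeFormula-≡ rot b e₁ e₂ eq =
    trans (sym (prismDist-edgeValue rot b e₁)) (trans eq (prismDist-edgeValue rot b e₂))

  -- fold L identifies x only with its reflection L − x, and x and prev x cannot both be reflected.
  edgeFormula-injective : ∀ κ₁ κ₂ {x₁ x₂} → x₁ < N → x₂ < N →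
                          edgeFormula true id κ₁ x₁ ≡ edgeFormula true id κ₂ x₂ →
                          edgeFormula false id κ₁ x₁ ≡ edgeFormula false id κ₂ x₂ →
                          edgeFormula true prev κ₁ x₁ ≡ edgeFormula true prev κ₂ x₂ →
                          κ₁ ≡ κ₂ × x₁ ≡ x₂
  edgeFormula-injective outer outer x₁<N x₂<N e₁ _ e₃ = refl , cycEdge-prev-injective x₁<N x₂<N e₁ e₃
  edgeFormula-injective spoke spoke x₁<N x₂<N e₁ _ e₃ = refl , cyc-prev-injective x₁<N x₂<N e₁ e₃
  edgeFormula-injective inner inner x₁<N x₂<N e₁ _ e₃ =
    refl , cycEdge-prev-injective x₁<N x₂<N (suc-injective e₁) (suc-injective e₃)
  edgeFormula-injective outer spoke _ _ e₁ e₂ _ = ⊥-elim (1+n≢n (trans e₂ (sym e₁)))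
  edgeFormula-injective outer inner _ _ e₁ e₂ _ = ⊥-elim (m≢1+n+m _ {1} (trans e₁ (cong suc (sym e₂))))
  edgeFormula-injective spoke outer _ _ e₁ e₂ _ = ⊥-elim (1+n≢n (trans (sym e₂) e₁))
  edgeFormula-injective spoke inner _ _ e₁ e₂ _ = ⊥-elim (1+n≢n (trans (sym e₁) e₂))
  edgeFormula-injective inner outer _ _ e₁ e₂ _ = ⊥-elim (m≢1+n+m _ {1} (sym (trans (cong suc (sym e₂)) e₁)))
  edgeFormula-injective inner spoke _ _ e₁ e₂ _ = ⊥-elim (1+n≢n (trans e₁ (sym e₂)))

  resolvingSet : List (Vtx N)
  resolvingSet = u 0F ∷ v 0F ∷ u (sucF 0F) ∷ []

  resolvingSet-unique : Unique resolvingSet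
  resolvingSet-unique = ((λ ()) ∷ (λ ()) ∷ []) ∷ ((λ ()) ∷ []) ∷ [] ∷ []

  dist-u₀ : ∀ x → Dist N 1 (u 0F) x (prismDist true id x)
  dist-u₀ = prismDist-Dist id-rotation 0F refl ring-walk-from-0 true

  dist-v₀ : ∀ x → Dist N 1 (v 0F) x (prismDist false id x)
  dist-v₀ = prismDist-Dist id-rotation 0F refl ring-walk-from-0 false

  dist-u₁ : ∀ x → Dist N 1 (u (sucF 0F)) x (prismDist true prev x)
  dist-u₁ = prismDist-Dist prev-rotation (sucF 0F) refl ring-walk-from-1 true

  SameEdge-of-edgeValues : (e₁ e₂ : Edge N 1) →
                           edgeValue (prismDist true id) e₁ ≡ edgeValue (prismDist true id) e₂ →
                           edgeValue (prismDist false id) e₁ ≡ edgeValue (prismDist false id) e₂ →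
                           edgeValue (prismDist true prev) e₁ ≡ edgeValue (prismDist true prev) e₂ →
                           SameEdge e₁ e₂
  SameEdge-of-edgeValues e₁ e₂ eq₁ eq₂ eq₃ =
    let κ≡ , i≡ = edgeFormula-injective (kind e₁) (kind e₂) (toℕ<n (base e₁)) (toℕ<n (base e₂))
                    (edgeFormula-≡ id-rotation true e₁ e₂ eq₁)
                    (edgeFormula-≡ id-rotation false e₁ e₂ eq₂)
                    (edgeFormula-≡ prev-rotation true e₁ e₂ eq₃)
    in SameEdge-of-kind-base e₁ e₂ κ≡ (toℕ-injective i≡)

  resolvingSet-generator : IsEdgeMetricGenerator N 1 resolvingSet
  resolvingSet-generator e₁ e₂ e₁≉e₂
    with edgeValue (prismDist true id) e₁ ≟ edgeValue (prismDist true id) e₂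
       | edgeValue (prismDist false id) e₁ ≟ edgeValue (prismDist false id) e₂
       | edgeValue (prismDist true prev) e₁ ≟ edgeValue (prismDist true prev) e₂
  ... | no ≢ | _ | _ = u 0F , here refl , Resolves-of-potential dist-u₀ e₁ e₂ ≢
  ... | yes _ | no ≢ | _ = v 0F , there (here refl) , Resolves-of-potential dist-v₀ e₁ e₂ ≢
  ... | yes _ | yes _ | no ≢ =
    u (sucF 0F) , there (there (here refl)) , Resolves-of-potential dist-u₁ e₁ e₂ ≢
  ... | yes eq₁ | yes eq₂ | yes eq₃ = ⊥-elim (e₁≉e₂ (SameEdge-of-edgeValues e₁ e₂ eq₁ eq₂ eq₃))

  next previous : Fin N → Fin N
  next i = fromℕ< (proj₁ (proj₂ (Succ-total (toℕ<n i))))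
  previous i = fromℕ< (prev<N (toℕ<n i))

  Succ-next : ∀ i → Succ (toℕ i) (toℕ (next i))
  Succ-next i with Succ-total (toℕ<n i)
  ... | _ , y<N , r = subst (Succ (toℕ i)) (sym (toℕ-fromℕ< y<N)) r

  Succ-previous : ∀ i → Succ (toℕ (previous i)) (toℕ i)
  Succ-previous i =
    subst (λ z → Succ z (toℕ i)) (sym (toℕ-fromℕ< (prev<N (toℕ<n i)))) (Succ-prev (toℕ i))

  ring-claw : ∀ b i → Claw {N} {1} (ring b i)
  ring-claw b i = mkClaw (ring-adj b (Succ-next i)) (ring-adj⁻ b (Succ-previous i)) (spoke-adj b)
    next≢prev ring≢ring-not ring≢ring-not
    where
    next≢prev : ring b (next i) ≢ ring b (previous i)
    next≢prev eq = Succ-asym (toℕ<n i) (toℕ<n (next i)) (Succ-next i)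
                     (subst (λ j → Succ (toℕ j) (toℕ i)) (sym (ring-injective eq)) (Succ-previous i))

  prism-claw : ∀ w → Claw {N} {1} w
  prism-claw (u i) = ring-claw true i
  prism-claw (v i) = ring-claw false i

  edgeMetricDim : EdgeMetricDim N 1 3
  edgeMetricDim = (resolvingSet , resolvingSet-unique , resolvingSet-generator , refl)
                , λ S _ → three-≤-generator prism-claw (u 0F) S

mainTheorem4 : (n : ℕ) → 3 ≤ n → EdgeMetricDim n 1 3
mainTheorem4 (suc (suc (suc m))) (s≤s (s≤s (s≤s _))) = Prism.edgeMetricDim m
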